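{- Let $n,k$ be natural numbers and $R$ a set of comparator networks that is size complete for $n$ channels and such that every $C\in R$ has size exactly $k$. Then every sorting network on $n$ channels has size at least $k$.
   Context: A comparator is a pair $(i,j)$ of natural numbers; a comparator network is a finite list of comparators, and its size is the number of comparators. $C_1;C_2$ denotes concatenation. A network $C$ is a network on $n$ channels if every comparator $(i,j)$ in it has $i<n$, $j<n$, $i\neq j$; it is standard on $n$ channels if every comparator $(i,j)$ in it has $i<j<n$. For $\vec x=(x_0,\ldots,x_{n-1})\in\{0,1\}^n$, applying comparator $(i,j)$ leaves $\vec x$ unchanged if $x_i\le x_j$ and otherwise swaps the entries at positions $i$ and $j$; $C(\vec x)$ is the result of applying the comparators of $C$ in order. $C$ is a sorting network on $n$ channels if it is a network on $n$ channels and $C(\vec x)$ is nondecreasing for all $\vec x\in\{0,1\}^n$. A comparator $c=(i,j)$ is redundant after $C_1$ if $C_1(\vec x)_i\le C_1(\vec x)_j$ for every $\vec x\in\{0,1\}^n$. A network $D$ has no redundant comparators if whenever $D=C_1;c;C_2$, $c$ is not redundant after $C_1$. A set $R$ of comparator networks is size complete for $n$ channels if for every $k'$: whenever there exists a sorting network on $n$ channels of size $k'$, there exist $C'\in R$ and a network $C''$ such that $C';C''$ is standard on $n$ channels, has no redundant comparators, is a sorting network on $n$ channels, and has size at most $k'$. -}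

module Defs where

open import Data.Nat using (ℕ; zero; suc; _<_; _≤_; _<?_; _≡ᵇ_)
open import Data.Nat.Properties using (<-cmp)
open import Data.Bool using (Bool; true; false; if_then_else_)
open import Data.Bool using () renaming (_≤_ to _≤ᵇ_)
open import Data.Fin using (Fin; toℕ; fromℕ<)
open import Data.Product using (_×_; _,_; Σ; ∃; ∃-syntax)
open import Data.List using (List; []; _∷_; _++_; length; [_])
open import Data.List.Relation.Unary.All using (All)
open import Relation.Nullary using (¬_; yes; no)
open import Relation.Binary.PropositionalEquality using (_≡_)

Comparator : Set
Comparator = ℕ × ℕ

Network : Set
Network = List Comparator

size : Network → ℕ
size = length

OnChannels : ℕ → Comparator → Set
OnChannels n (i , j) = i < n × j < n × ¬ (i ≡ j)

NetworkOn : ℕ → Network → Set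
NetworkOn n C = All (OnChannels n) C

StandardOn : ℕ → Network → Set
StandardOn n C = All (λ { (i , j) → i < j × j < n }) C

Input : ℕ → Set
Input n = Fin n → Bool

-- Value at a natural-number position (only used for positions < n;
-- out-of-range positions read as false, and are never used for
-- networks on n channels).
at : ∀ {n} → Input n → ℕ → Bool
at {n} x i with i <? n
... | yes p = x (fromℕ< p)
... | no _  = false

leqᵇ : Bool → Bool → Bool
leqᵇ true false = false
leqᵇ _ _ = true

-- Applying comparator (i , j): unchanged if x_i ≤ x_j, otherwise swap
-- entries at positions i and j.  (Out-of-range comparators act as the
-- identity; this never matters for networks on n channels.)
applyComp : ∀ {n} → Comparator → Input n → Input n
applyComp {n} (i , j) x with i <? n | j <? n
... | yes _ | yes _ =
  if leqᵇ (at x i) (at x j) then x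
  else (λ k → if toℕ k ≡ᵇ i then at x j else if toℕ k ≡ᵇ j then at x i else x k)
... | _ | _ = x

run : ∀ {n} → Network → Input n → Input n
run [] x = x
run (c ∷ C) x = run C (applyComp c x)

Sorted : ∀ {n} → Input n → Set
Sorted {n} y = ∀ (a b : Fin n) → toℕ a ≤ toℕ b → y a ≤ᵇ y b

SortingNetwork : ℕ → Network → Set
SortingNetwork n C = NetworkOn n C × (∀ (x : Input n) → Sorted (run C x))

RedundantAfter : ℕ → Comparator → Network → Set
RedundantAfter n (i , j) C₁ = ∀ (x : Input n) → at (run C₁ x) i ≤ᵇ at (run C₁ x) j

NoRedundant : ℕ → Network → Set
NoRedundant n D = ∀ (C₁ : Network) (c : Comparator) (C₂ : Network) →
  D ≡ C₁ ++ (c ∷ C₂) → ¬ RedundantAfter n c C₁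

SizeComplete : ℕ → (Network → Set) → Set
SizeComplete n R = ∀ (k' : ℕ) →
  (∃[ S ] (SortingNetwork n S × size S ≡ k')) →
  ∃[ C' ] ∃[ C'' ] (R C' × StandardOn n (C' ++ C'') × NoRedundant n (C' ++ C'')
                    × SortingNetwork n (C' ++ C'') × size (C' ++ C'') ≤ k')

module Submission where

open import Defs
open import Data.Nat using (ℕ; _≤_)
open import Data.Nat.Properties using (≤-trans; m≤m+n; ≤-reflexive; module ≤-Reasoning)
open import Data.List.Properties using (length-++)
open import Data.List using (_++_)
open import Data.Product using (_,_)
open import Relation.Binary.PropositionalEquality using (_≡_; refl; sym)

size-prefix≤size-++ : ∀ C C'' → size C ≤ size (C ++ C'')
size-prefix≤size-++ C C'' = ≤-trans (m≤m+n (size C) (size C'')) (≤-reflexive (sym (length-++ C)))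

mainTheorem3 : (n k : ℕ) (R : Network → Set) → SizeComplete n R →
    (∀ C → R C → size C ≡ k) →
    ∀ (S : Network) → SortingNetwork n S → k ≤ size S
mainTheorem3 n k R complete sizeR S sortingS
  with complete (size S) (S , sortingS , refl)
... | C' , C'' , C'∈R , _ , _ , _ , extension≤S = begin
  k                  ≡⟨ sym (sizeR C' C'∈R) ⟩
  size C'            ≤⟨ size-prefix≤size-++ C' C'' ⟩
  size (C' ++ C'')   ≤⟨ extension≤S ⟩
  size S             ∎
  where open ≤-Reasoning
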